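{- $\mathfrak{b}\leq\Delta_{\text{Fin-1}}$.
   Context: Let $\square_{\text{Fin-1}}$ be the set of finite-to-one $f\in\omega^\omega$ without fixed points. $\Delta_{\text{Fin-1}}$ is the least size of a family $\mathcal{F}\subseteq\square_{\text{Fin-1}}$ such that for every $A\in[\omega]^\omega$ there is $f\in\mathcal{F}$ with $f[A]\cap A$ infinite. $\mathfrak{b}$ is the bounding number. -}

module Defs where

open import Data.Nat using (ℕ; _≤_; _<_)
open import Data.Product using (Σ; ∃; ∃-syntax; _×_)
open import Relation.Binary.PropositionalEquality using (_≡_; _≢_)
open import Relation.Nullary using (¬_)

Subset : Set₁
Subset = ℕ → Set

Infinite : Subset → Set
Infinite A = ∀ n → ∃[ m ] (n ≤ m × A m)

FiniteToOne : (ℕ → ℕ) → Set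
FiniteToOne f = ∀ m → ∃[ N ] (∀ n → f n ≡ m → n < N)

FixedPointFree : (ℕ → ℕ) → Set
FixedPointFree f = ∀ n → f n ≢ n

InSquareFin1 : (ℕ → ℕ) → Set
InSquareFin1 f = FiniteToOne f × FixedPointFree f

Image : (ℕ → ℕ) → Subset → Subset
Image f A m = ∃[ a ] (A a × f a ≡ m)

_∩_ : Subset → Subset → Subset
(A ∩ B) m = A m × B m

DeltaFin1Family : (I : Set) → (I → ℕ → ℕ) → Set₁
DeltaFin1Family I F =
  (∀ i → InSquareFin1 (F i)) ×
  (∀ (A : Subset) → Infinite A → ∃[ i ] Infinite (Image (F i) A ∩ A))

_≤*_ : (ℕ → ℕ) → (ℕ → ℕ) → Set
f ≤* g = ∃[ N ] (∀ n → N ≤ n → f n ≤ g n)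

Unbounded : (I : Set) → (I → ℕ → ℕ) → Set
Unbounded I G = ¬ (∃[ g ] (∀ i → G i ≤* g))

{-# OPTIONS --safe #-}
module Submission where

open import Defs
open import Data.Nat using (ℕ; zero; suc; _+_; _≤_; _<_; _>_; _≤′_; ≤′-refl; ≤′-step; s≤s)
open import Data.Nat.Properties
open import Data.Product using (∃-syntax; _,_; proj₁; proj₂)
open import Data.Sum using (inj₁; inj₂)
open import Data.Empty using (⊥; ⊥-elim)
open import Function using (_∘_)
open import Relation.Binary using (Tri; tri<; tri≈; tri>)
open import Relation.Binary.PropositionalEquality using (_≡_; refl; sym)
open import Relation.Nullary using (¬_)

-- Given g, let 0 = a₀ < a₁ < … with g (aₖ) < aₖ₊₁, and A = {aₖ}.  If g eventually
-- dominates a fixed-point-free finite-to-one f and the bounds on its fibres, then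
-- f (aⱼ) = aₖ forces j to be small: k > j is ruled out by f (aⱼ) ≤ g (aⱼ) < aⱼ₊₁,
-- k = j by the absence of fixed points, and k < j because aⱼ lies above the fibre of aₖ.
-- So f[A] ∩ A is finite, and no g can dominate these majorants of all members of a
-- family witnessing Δ_Fin-1.

sumBelow : (ℕ → ℕ) → ℕ → ℕ
sumBelow h zero = zero
sumBelow h (suc n) = h n + sumBelow h n

≤-sumBelow : ∀ h {j n} → j < n → h j ≤ sumBelow h n
≤-sumBelow h = go ∘ ≤⇒≤′
  where
  go : ∀ {j n} → suc j ≤′ n → h j ≤ sumBelow h n
  go ≤′-refl = m≤m+n _ _
  go (≤′-step p) = ≤-trans (go p) (m≤n+m _ _)

Range : (ℕ → ℕ) → Subset
Range a m = ∃[ k ] (a k ≡ m)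

range-infinite : ∀ {a} → (∀ k → k ≤ a k) → Infinite (Range a)
range-infinite inflationary n = _ , inflationary n , n , refl

boundedBy⇒¬infinite : ∀ {B : Subset} b → (∀ m → B m → m ≤ b) → ¬ Infinite B
boundedBy⇒¬infinite b bounded infinite with infinite (suc b)
... | m , b<m , m∈B = <⇒≱ b<m (bounded m m∈B)

module _ (g : ℕ → ℕ) where

  sparseSeq : ℕ → ℕ
  sparseSeq zero = zero
  sparseSeq (suc k) = suc (sparseSeq k + g (sparseSeq k))

  sparseSeq-outruns : ∀ k → g (sparseSeq k) < sparseSeq (suc k)
  sparseSeq-outruns k = s≤s (m≤n+m _ _)

  sparseSeq-monotone : ∀ {j k} → j ≤ k → sparseSeq j ≤ sparseSeq k
  sparseSeq-monotone = go ∘ ≤⇒≤′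
    where
    go : ∀ {j k} → j ≤′ k → sparseSeq j ≤ sparseSeq k
    go ≤′-refl = ≤-refl
    go (≤′-step p) = m≤n⇒m≤1+n (≤-trans (go p) (m≤m+n _ _))

  sparseSeq-outruns-later : ∀ {j k} → j < k → g (sparseSeq j) < sparseSeq k
  sparseSeq-outruns-later {j} j<k = <-≤-trans (sparseSeq-outruns j) (sparseSeq-monotone j<k)

  sparseSeq-inflationary : ∀ k → k ≤ sparseSeq k
  sparseSeq-inflationary zero = ≤-refl
  sparseSeq-inflationary (suc k) = s≤s (≤-trans (sparseSeq-inflationary k) (m≤m+n _ _))

module _ {f g N : ℕ → ℕ} {D : ℕ}
         (fixedPointFree : FixedPointFree f)
         (fibreBelow : ∀ n m → f n ≡ m → n < N m)
         (g-dominates-f : ∀ n → D ≤ n → f n ≤ g n)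
         (g-dominates-N : ∀ n m → D ≤ n → m ≤ n → N m ≤ g n) where

  private
    a : ℕ → ℕ
    a = sparseSeq g

  image-index-bounded : ∀ {j k} → f (a j) ≡ a k → j ≤ D
  image-index-bounded {j} {k} e with ≤-<-connex j D
  ... | inj₁ j≤D = j≤D
  ... | inj₂ D<j = ⊥-elim (impossible (<-cmp j k) D<j)
    where
    impossible : Tri (j < k) (j ≡ k) (j > k) → D < j → ⊥
    impossible (tri< j<k _ _) D<j =
      <-irrefl e (≤-<-trans (g-dominates-f (a j) D≤aⱼ) (sparseSeq-outruns-later g j<k))
      where
      D≤aⱼ : D ≤ a j
      D≤aⱼ = ≤-trans (<⇒≤ D<j) (sparseSeq-inflationary g j)
    impossible (tri≈ _ refl _) _ = fixedPointFree (a j) e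
    impossible (tri> _ _ (s≤s {n = j′} k≤j′)) (s≤s D≤j′) =
      <-irrefl refl (begin-strict
        a (suc j′)     <⟨ fibreBelow (a (suc j′)) (a k) e ⟩
        N (a k)        ≤⟨ g-dominates-N (a j′) (a k) D≤aⱼ′ (sparseSeq-monotone g k≤j′) ⟩
        g (a j′)       <⟨ sparseSeq-outruns g j′ ⟩
        a (suc j′)     ∎)
      where
      open ≤-Reasoning
      D≤aⱼ′ : D ≤ a j′
      D≤aⱼ′ = ≤-trans D≤j′ (sparseSeq-inflationary g j′)

  image∩range-boundedBy : ∀ m → (Image f (Range a) ∩ Range a) m → m ≤ sumBelow (f ∘ a) (suc D)
  image∩range-boundedBy _ ((_ , (j , refl) , refl) , (k , e)) =
    ≤-sumBelow (f ∘ a) (s≤s (image-index-bounded (sym e)))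

module _ {f : ℕ → ℕ} (finiteToOne : FiniteToOne f) where

  fibreBound : ℕ → ℕ
  fibreBound m = proj₁ (finiteToOne m)

  fibreMajorant : ℕ → ℕ
  fibreMajorant n = f n + sumBelow fibreBound (suc n)

  fibreMajorant-≥-f : ∀ n → f n ≤ fibreMajorant n
  fibreMajorant-≥-f n = m≤m+n _ _

  fibreMajorant-≥-fibreBound : ∀ {n m} → m ≤ n → fibreBound m ≤ fibreMajorant n
  fibreMajorant-≥-fibreBound {n} m≤n = ≤-trans (≤-sumBelow fibreBound (s≤s m≤n)) (m≤n+m _ (f n))

image∩range-finite : ∀ {f g} (inSquare : InSquareFin1 f) → fibreMajorant (proj₁ inSquare) ≤* g →
  ¬ Infinite (Image f (Range (sparseSeq g)) ∩ Range (sparseSeq g))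
image∩range-finite {f} {g} (finiteToOne , fixedPointFree) (D , dominated) =
  boundedBy⇒¬infinite _ (image∩range-boundedBy fixedPointFree fibreBelow g-dominates-f g-dominates-N)
  where
  fibreBelow : ∀ n m → f n ≡ m → n < fibreBound finiteToOne m
  fibreBelow n m = proj₂ (finiteToOne m) n
  g-dominates-f : ∀ n → D ≤ n → f n ≤ g n
  g-dominates-f n D≤n = ≤-trans (fibreMajorant-≥-f finiteToOne n) (dominated n D≤n)
  g-dominates-N : ∀ n m → D ≤ n → m ≤ n → fibreBound finiteToOne m ≤ g n
  g-dominates-N n m D≤n m≤n = ≤-trans (fibreMajorant-≥-fibreBound finiteToOne m≤n) (dominated n D≤n)

mainTheorem6 : (I : Set) (F : I → ℕ → ℕ) → DeltaFin1Family I F →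
    ∃[ G ] Unbounded I G
mainTheorem6 I F (inSquare , witnesses) = G , λ { (g , dominated) → refute g dominated }
  where
  G : I → ℕ → ℕ
  G i = fibreMajorant (proj₁ (inSquare i))

  refute : ∀ g → (∀ i → G i ≤* g) → ⊥
  refute g dominated with witnesses _ (range-infinite (sparseSeq-inflationary g))
  ... | i , infinite = image∩range-finite (inSquare i) (dominated i) infinite
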